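{- Let $G$ be a connected bipartite graph with at least $3$ vertices. The third invariant factor of the distance matrix $D(G)$ equals $2$, except when $G=K_{2,2}$ or $G=P_3$, in which case the third invariant factor of $D(G)$ equals $4$.
   Context: For a connected graph $G$, the distance matrix $D(G)$ has $uv$-entry $d_G(u,v)$, the graph distance. For an integer square matrix $M$ of rank $r$, its Smith normal form is the unique diagonal matrix $\operatorname{diag}(f_1,\dots,f_r,0,\dots,0)$ equivalent to $M$ over $\mathbb Z$ (i.e. $M=PNQ$ with $P,Q$ unimodular) with $f_i>0$ and $f_i\mid f_{i+1}$; the $f_i$ are the invariant factors, and $f_i=\Delta_i(M)/\Delta_{i-1}(M)$ where $\Delta_i(M)$ is the gcd of the $i\times i$ minors and $\Delta_0=1$. -}

module Defs where

open import Data.Nat using (ℕ; zero; suc; _<_; _*_)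
open import Data.Nat.GCD using (gcd)
open import Data.Integer as ℤ using (ℤ; ∣_∣)
open import Data.Fin using (Fin; zero; suc; punchIn)
open import Data.List using (List; []; _∷_; _++_; map; foldr; concatMap; allFin)
open import Data.Product using (Σ; _×_; ∃)
open import Data.Sum using (_⊎_)
open import Data.Bool using (Bool)
open import Data.Empty using (⊥)
open import Data.Unit using (⊤)
open import Relation.Nullary using (¬_)
open import Relation.Binary.PropositionalEquality using (_≡_; _≢_)
open import Function.Bundles using (_↔_; _⇔_; Inverse)

record Graph (n : ℕ) : Set₁ where
  field
    Adj   : Fin n → Fin n → Set
    sym   : ∀ {u v} → Adj u v → Adj v u
    irrefl : ∀ {u} → ¬ Adj u u
open Graph public

data Walk {n : ℕ} (G : Graph n) : Fin n → Fin n → ℕ → Set where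
  nil  : ∀ {u} → Walk G u u 0
  cons : ∀ {u w v k} → Adj G u w → Walk G w v k → Walk G u v (suc k)

Connected : ∀ {n} → Graph n → Set
Connected G = ∀ u v → ∃ λ k → Walk G u v k

Bipartite : ∀ {n} → Graph n → Set
Bipartite {n} G = Σ (Fin n → Bool) λ c → ∀ u v → Adj G u v → c u ≢ c v

IsDistanceMatrix : ∀ {n} → Graph n → (Fin n → Fin n → ℕ) → Set
IsDistanceMatrix G D =
  ∀ u v → Walk G u v (D u v) × (∀ k → Walk G u v k → ¬ (k < D u v))

_≅_ : ∀ {n m} → Graph n → Graph m → Set
_≅_ {n} {m} G H = Σ (Fin n ↔ Fin m) λ f →
  ∀ u v → Adj G u v ⇔ Adj H (Inverse.to f u) (Inverse.to f v)

side : Fin 4 → Bool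
side zero = Bool.true
side (suc zero) = Bool.true
side _ = Bool.false

K22-adj : Fin 4 → Fin 4 → Set
K22-adj u v = side u ≢ side v

K22 : Graph 4
K22 = record { Adj = K22-adj ; sym = λ p q → p (Relation.Binary.PropositionalEquality.sym q)
             ; irrefl = λ p → p Relation.Binary.PropositionalEquality.refl }

P3-adj : Fin 3 → Fin 3 → Set
P3-adj zero (suc zero) = ⊤
P3-adj (suc zero) zero = ⊤
P3-adj (suc zero) (suc (suc zero)) = ⊤
P3-adj (suc (suc zero)) (suc zero) = ⊤
P3-adj _ _ = ⊥

P3-sym : ∀ {u v} → P3-adj u v → P3-adj v u
P3-sym {zero} {suc zero} _ = _
P3-sym {suc zero} {zero} _ = _
P3-sym {suc zero} {suc (suc zero)} _ = _
P3-sym {suc (suc zero)} {suc zero} _ = _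

P3-irr : ∀ {u} → ¬ P3-adj u u
P3-irr {zero} ()
P3-irr {suc zero} ()
P3-irr {suc (suc zero)} ()

P3 : Graph 3
P3 = record { Adj = P3-adj ; sym = P3-sym ; irrefl = P3-irr }

Matrix : ℕ → ℕ → Set
Matrix m k = Fin m → Fin k → ℤ

sumℤ : List ℤ → ℤ
sumℤ = foldr ℤ._+_ (ℤ.+ 0)

sign : ℕ → ℤ
sign zero = ℤ.+ 1
sign (suc zero) = ℤ.- (ℤ.+ 1)
sign (suc (suc j)) = sign j

det : ∀ {k} → Matrix k k → ℤ
det {zero} M = ℤ.+ 1
det {suc k} M = sumℤ (map (λ j → sign (Data.Fin.toℕ j) ℤ.* (M zero j ℤ.* det (λ r c → M (suc r) (punchIn j c)))) (allFin (suc k)))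

-- all strictly increasing maps Fin k → Fin n (i.e. k-subsets of Fin n)
choose : (n k : ℕ) → List (Fin k → Fin n)
choose n zero = (λ ()) ∷ []
choose zero (suc k) = []
choose (suc n) (suc k) =
  map (λ f → λ { zero → zero ; (suc i) → suc (f i) }) (choose n k)
  ++ map (λ f i → suc (f i)) (choose n (suc k))

minors : ∀ {n} → ℕ → Matrix n n → List ℤ
minors {n} k M = concatMap (λ rs → map (λ cs → det (λ i j → M (rs i) (cs j))) (choose n k)) (choose n k)

gcdList : List ℕ → ℕ
gcdList = foldr gcd 0

Δ : ∀ {n} → ℕ → Matrix n n → ℕ
Δ k M = gcdList (map ∣_∣ (minors k M))

-- f is the k-th invariant factor of M (k ≥ 1): f = Δ_k / Δ_{k-1}, with f > 0
-- (i.e. rank M ≥ k)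
IsInvariantFactor : ∀ {n} → Matrix n n → ℕ → ℕ → Set
IsInvariantFactor M zero f = ⊥
IsInvariantFactor M (suc k) f = Δ k M ≢ 0 × Δ (suc k) M ≢ 0 × Δ (suc k) M ≡ f * Δ k M

toℤMatrix : ∀ {n} → (Fin n → Fin n → ℕ) → Matrix n n
toℤMatrix D i j = ℤ.+ (D i j)

{-# OPTIONS --safe #-}
module Submission where

-- Colour G properly by c. Every distance satisfies D u v ≡ c u + c v (mod 2), so D is congruent
-- mod 2 to a matrix of rank at most 2 and all its 3×3 minors are even, while an edge gives the
-- 2×2 minor -1; hence Δ₂ = 1 and the third invariant factor is Δ₃. By pigeonhole on the colours
-- G contains a path x ─ y ─ z with x ≠ z, whose 3×3 distance submatrix has determinant 4, so
-- 2 ∣ Δ₃ ∣ 4. Unless G is P₃ or K₂,₂, a vertex next to that path (or next to a 4-cycle through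
-- it) creates an induced claw K₁,₃ or an induced path P₄, both with a 3×3 distance minor ±2;
-- hence Δ₃ = 2. For P₃ and K₂,₂ every 3×3 minor is divisible by 4, which is checked by
-- evaluation, so Δ₃ = 4.

open import Defs hiding (sym)
open import Data.Nat using (ℕ; _≤_)
open import Data.Fin using (Fin)
open import Data.Product using (_×_)
open import Data.Sum using (_⊎_)
open import Relation.Nullary using (¬_)

open import Algebra.Bundles.Raw using (RawRing)
open import Data.Bool as Bool using (Bool; true; false; not)
open import Data.Bool.Properties using (¬-not; not-¬; not-involutive)
open import Data.Empty using (⊥-elim)
open import Data.Fin as F using (zero; suc; punchIn)
open import Data.Fin.Patterns using (0F; 1F; 2F; 3F)
open import Data.Fin.Properties
  using ( _≟_; 0≢1+n; <-cmp; <-trans; <⇒≢; punchIn-punchOut; pigeonhole; 2↔Bool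
        ; any?; all?; ¬∀⟶∃¬; injective⇒≤)
open import Data.Integer using (ℤ; +_; ∣_∣; +-*-rawRing)
import Data.Integer.Properties as ℤ
open import Data.Integer.Solver using (module +-*-Solver)
open import Data.Integer.Tactic.RingSolver using (solve-∀)
open import Data.List using (_∷_; map; allFin)
open import Data.List.Membership.Propositional using (_∈_)
open import Data.List.Properties using (map-cong)
open import Data.List.Relation.Unary.All as All using (All; []; _∷_)
import Data.List.Relation.Unary.All.Properties as All
open import Data.List.Relation.Unary.Any as Any using (Any; here; there)
import Data.List.Relation.Unary.Any.Properties as Any
open import Data.Nat as ℕ using (zero; suc)
import Data.Nat.Properties as ℕ
open import Data.Nat.Divisibility using (_∣_; _∣?_; ∣-trans; _∣0; m∣m*n; ∣1⇒≡1; ∣-antisym)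
open import Data.Nat.GCD using (gcd[m,n]∣m; gcd[m,n]∣n; gcd-greatest)
open import Data.Product using (∃; _,_; proj₁; proj₂)
open import Data.Sum using (inj₁; inj₂)
open import Data.Unit using (tt)
open import Data.Vec using (_∷_; []; lookup)
import Data.Vec.Functional as Vector
open import Data.Vec.Relation.Unary.All using ([]; _∷_)
open import Data.Vec.Relation.Unary.AllPairs using ([]; _∷_)
open import Data.Vec.Relation.Unary.Unique.Propositional using (Unique)
open import Data.Vec.Relation.Unary.Unique.Propositional.Properties using (lookup-injective)
open import Function using (_∘_)
open import Function.Bundles using (Inverse; Equivalence; _⇔_; mk⇔; mk↔ₛ′)
open import Function.Definitions using (Injective)
open import Level using (0ℓ)
open import Relation.Binary.Core using (_Preserves_⟶_)
open import Relation.Binary.Definitions using (tri<; tri≈; tri>)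
open import Relation.Binary.PropositionalEquality
open import Relation.Nullary using (yes; no)
open import Relation.Nullary.Decidable using (Dec; toWitness)

private
  variable
    m n k : ℕ

module Determinant (R : RawRing 0ℓ 0ℓ) where
  open RawRing R

  det₂ : Carrier → Carrier → Carrier → Carrier → Carrier
  det₂ a b c d = a * d + - (b * c)

  det₃ : Carrier → Carrier → Carrier → Carrier → Carrier → Carrier → Carrier → Carrier → Carrier → Carrier
  det₃ a b c d e f g h i = a * det₂ e f h i + - (b * det₂ d f g i) + c * det₂ d e g h

open Determinant +-*-rawRing public
open import Data.Integer using (_+_; _*_; -_; _-_)
open +-*-Solver using (Polynomial; con; _:+_; _:*_; :-_; _:=_; solve)

-- The solver's syntax as a raw ring, so that identities about det₃ can be stated with det₃ itself.
polynomials : ℕ → RawRing 0ℓ 0ℓ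
polynomials n = record
  { Carrier = Polynomial n ; _≈_ = _≡_ ; _+_ = _:+_ ; _*_ = _:*_ ; -_ = :-_
  ; 0# = con (+ 0) ; 1# = con (+ 1) }

module Symbolic (n : ℕ) = Determinant (polynomials n)

laplace-minor : Fin (suc k) → Matrix (suc k) (suc k) → Matrix k k
laplace-minor j M r c = M (suc r) (punchIn j c)

det-1×1 : (M : Matrix 1 1) → det M ≡ M 0F 0F
det-1×1 M = trans (ℤ.+-identityʳ _) (trans (ℤ.*-identityˡ _) (ℤ.*-identityʳ _))

-- The left-hand sides are how det in Defs unfolds on a first row of length 2 and 3.
first-row-expansion₂ : ∀ a b {x y x′ y′} → x ≡ x′ → y ≡ y′ →
  + 1 * (a * x) + (- + 1 * (b * y) + + 0) ≡ a * x′ + - (b * y′)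
first-row-expansion₂ a b {x′ = x′} {y′} refl refl = signs a b x′ y′
  where
  signs : ∀ a b x y → + 1 * (a * x) + (- + 1 * (b * y) + + 0) ≡ a * x + - (b * y)
  signs = solve-∀

first-row-expansion₃ : ∀ a b c {x y z x′ y′ z′} → x ≡ x′ → y ≡ y′ → z ≡ z′ →
  + 1 * (a * x) + (- + 1 * (b * y) + (+ 1 * (c * z) + + 0)) ≡ a * x′ + - (b * y′) + c * z′
first-row-expansion₃ a b c {x′ = x′} {y′} {z′} refl refl refl = signs a b c x′ y′ z′
  where
  signs : ∀ a b c x y z → + 1 * (a * x) + (- + 1 * (b * y) + (+ 1 * (c * z) + + 0)) ≡ a * x + - (b * y) + c * z
  signs = solve-∀

det-2×2 : (M : Matrix 2 2) → det M ≡ det₂ (M 0F 0F) (M 0F 1F) (M 1F 0F) (M 1F 1F)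
det-2×2 M = first-row-expansion₂ (M 0F 0F) (M 0F 1F) (det-1×1 (laplace-minor 0F M)) (det-1×1 (laplace-minor 1F M))

det-3×3 : (M : Matrix 3 3) →
  det M ≡ det₃ (M 0F 0F) (M 0F 1F) (M 0F 2F) (M 1F 0F) (M 1F 1F) (M 1F 2F) (M 2F 0F) (M 2F 1F) (M 2F 2F)
det-3×3 M = first-row-expansion₃ (M 0F 0F) (M 0F 1F) (M 0F 2F)
  (det-2×2 (laplace-minor 0F M)) (det-2×2 (laplace-minor 1F M)) (det-2×2 (laplace-minor 2F M))

det₃-swap-rows₁₂ : ∀ a b c d e f g h i → det₃ d e f a b c g h i ≡ - det₃ a b c d e f g h i
det₃-swap-rows₁₂ = solve 9 (λ a b c d e f g h i → P d e f a b c g h i := :- P a b c d e f g h i) refl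
  where open Symbolic 9 using () renaming (det₃ to P)

det₃-swap-rows₂₃ : ∀ a b c d e f g h i → det₃ a b c g h i d e f ≡ - det₃ a b c d e f g h i
det₃-swap-rows₂₃ = solve 9 (λ a b c d e f g h i → P a b c g h i d e f := :- P a b c d e f g h i) refl
  where open Symbolic 9 using () renaming (det₃ to P)

det₃-swap-cols₁₂ : ∀ a b c d e f g h i → det₃ b a c e d f h g i ≡ - det₃ a b c d e f g h i
det₃-swap-cols₁₂ = solve 9 (λ a b c d e f g h i → P b a c e d f h g i := :- P a b c d e f g h i) refl
  where open Symbolic 9 using () renaming (det₃ to P)

det₃-swap-cols₂₃ : ∀ a b c d e f g h i → det₃ a c b d f e g i h ≡ - det₃ a b c d e f g h i
det₃-swap-cols₂₃ = solve 9 (λ a b c d e f g h i → P a c b d f e g i h := :- P a b c d e f g h i) refl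
  where open Symbolic 9 using () renaming (det₃ to P)

-- Expand multilinearly in the rows: every term but det₃ (xᵢ + yⱼ) carries a factor 2,
-- and that one vanishes because the matrix (xᵢ + yⱼ) has rank at most 2.
rank-two-parity : ∀ x₀ x₁ x₂ y₀ y₁ y₂ r₀₀ r₀₁ r₀₂ r₁₀ r₁₁ r₁₂ r₂₀ r₂₁ r₂₂ → ∃ λ w →
  det₃ (x₀ + y₀ + + 2 * r₀₀) (x₀ + y₁ + + 2 * r₀₁) (x₀ + y₂ + + 2 * r₀₂)
       (x₁ + y₀ + + 2 * r₁₀) (x₁ + y₁ + + 2 * r₁₁) (x₁ + y₂ + + 2 * r₁₂)
       (x₂ + y₀ + + 2 * r₂₀) (x₂ + y₁ + + 2 * r₂₁) (x₂ + y₂ + + 2 * r₂₂) ≡ + 2 * w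
rank-two-parity x₀ x₁ x₂ y₀ y₁ y₂ r₀₀ r₀₁ r₀₂ r₁₀ r₁₁ r₁₂ r₂₀ r₂₁ r₂₂ = _ ,
  solve 15 (λ x₀ x₁ x₂ y₀ y₁ y₂ r₀₀ r₀₁ r₀₂ r₁₀ r₁₁ r₁₂ r₂₀ r₂₁ r₂₂ →
    let two = con (+ 2)
        X₀ = x₀ :+ y₀ ; X₁ = x₀ :+ y₁ ; X₂ = x₀ :+ y₂
        Y₀ = x₁ :+ y₀ ; Y₁ = x₁ :+ y₁ ; Y₂ = x₁ :+ y₂
        Z₀ = x₂ :+ y₀ ; Z₁ = x₂ :+ y₁ ; Z₂ = x₂ :+ y₂
    in  P (X₀ :+ two :* r₀₀) (X₁ :+ two :* r₀₁) (X₂ :+ two :* r₀₂)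
          (Y₀ :+ two :* r₁₀) (Y₁ :+ two :* r₁₁) (Y₂ :+ two :* r₁₂)
          (Z₀ :+ two :* r₂₀) (Z₁ :+ two :* r₂₁) (Z₂ :+ two :* r₂₂)
        := two :* (P r₀₀ r₀₁ r₀₂ Y₀ Y₁ Y₂ Z₀ Z₁ Z₂
                   :+ P X₀ X₁ X₂ r₁₀ r₁₁ r₁₂ Z₀ Z₁ Z₂
                   :+ P X₀ X₁ X₂ Y₀ Y₁ Y₂ r₂₀ r₂₁ r₂₂
                   :+ two :* (P r₀₀ r₀₁ r₀₂ r₁₀ r₁₁ r₁₂ Z₀ Z₁ Z₂
                              :+ P r₀₀ r₀₁ r₀₂ Y₀ Y₁ Y₂ r₂₀ r₂₁ r₂₂
                              :+ P X₀ X₁ X₂ r₁₀ r₁₁ r₁₂ r₂₀ r₂₁ r₂₂)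
                   :+ con (+ 4) :* P r₀₀ r₀₁ r₀₂ r₁₀ r₁₁ r₁₂ r₂₀ r₂₁ r₂₂))
    refl x₀ x₁ x₂ y₀ y₁ y₂ r₀₀ r₀₁ r₀₂ r₁₀ r₁₁ r₁₂ r₂₀ r₂₁ r₂₂
  where open Symbolic 15 using () renaming (det₃ to P)

∣double∣-even : ∀ {z} → (∃ λ w → z ≡ + 2 * w) → 2 ∣ ∣ z ∣
∣double∣-even (w , refl) = subst (2 ∣_) (sym (ℤ.abs-* (+ 2) w)) (m∣m*n ∣ w ∣)

det-even : (x y : Fin 3 → ℤ) (r : Matrix 3 3) → 2 ∣ ∣ det (λ i j → x i + y j + + 2 * r i j) ∣
det-even x y r = subst (2 ∣_) (cong ∣_∣ (sym (det-3×3 (λ i j → x i + y j + + 2 * r i j))))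
  (∣double∣-even (rank-two-parity (x 0F) (x 1F) (x 2F) (y 0F) (y 1F) (y 2F)
    (r 0F 0F) (r 0F 1F) (r 0F 2F) (r 1F 0F) (r 1F 1F) (r 1F 2F) (r 2F 0F) (r 2F 1F) (r 2F 2F)))

det-cong : {M N : Matrix k k} → (∀ i j → M i j ≡ N i j) → det M ≡ det N
det-cong {zero} _ = refl
det-cong {suc k} M≡N = cong sumℤ (map-cong (λ j →
  cong₂ (λ a b → sign (F.toℕ j) * (a * b)) (M≡N 0F j) (det-cong (λ r c → M≡N (suc r) (punchIn j c))))
  (allFin (suc k)))

minor : Matrix n n → (Fin k → Fin n) → (Fin k → Fin n) → ℤ
minor M rows cols = det (λ i j → M (rows i) (cols j))

minor-cong : (M : Matrix n n) {f f′ g g′ : Fin k → Fin n} → f ≗ f′ → g ≗ g′ →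
             minor M f g ≡ minor M f′ g′
minor-cong M f≗f′ g≗g′ = det-cong (λ i j → cong₂ M (f≗f′ i) (g≗g′ j))

gcdList-∣ : ∀ {x xs} → x ∈ xs → gcdList xs ∣ x
gcdList-∣ {xs = y ∷ ys} (here refl) = gcd[m,n]∣m y (gcdList ys)
gcdList-∣ {xs = y ∷ ys} (there x∈ys) = ∣-trans (gcd[m,n]∣n y (gcdList ys)) (gcdList-∣ x∈ys)

∣-gcdList : ∀ {d xs} → All (d ∣_) xs → d ∣ gcdList xs
∣-gcdList {d} [] = d ∣0
∣-gcdList (d∣x ∷ d∣xs) = gcd-greatest d∣x (∣-gcdList d∣xs)

Increasing : (Fin k → Fin n) → Set
Increasing f = f Preserves F._<_ ⟶ F._<_

private
  ≢zero : {a b : Fin (suc n)} → a F.< b → b ≢ zero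
  ≢zero a<0 refl = ℕ.n≮0 a<0

  unshift : (f : Fin k → Fin (suc n)) → (∀ i → f i ≢ zero) → ∃ λ h → ∀ i → suc (h i) ≡ f i
  unshift f f≢0 = (λ i → F.punchOut (f≢0 i ∘ sym)) , (λ i → punchIn-punchOut (f≢0 i ∘ sym))

  unshift-increasing : {f : Fin k → Fin (suc n)} {h : Fin k → Fin n} →
                       (∀ i → suc (h i) ≡ f i) → Increasing f → Increasing h
  unshift-increasing h≡f f↑ {i} {j} i<j = ℕ.s<s⁻¹ (subst₂ F._<_ (sym (h≡f i)) (sym (h≡f j)) (f↑ i<j))

choose-complete : (f : Fin k → Fin n) → Increasing f → Any (_≗ f) (choose n k)
choose-complete {zero} f _ = here (λ ())
choose-complete {suc k} {zero} f _ with f zero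
... | ()
choose-complete {suc k} {suc n} f f↑ with f zero in f0
... | zero with h , h≡f ← unshift (f ∘ suc) (λ i → ≢zero (f↑ {zero} {suc i} ℕ.z<s)) =
  Any.++⁺ˡ (Any.map⁺ (Any.map (λ g≗h → λ { zero → sym f0 ; (suc i) → trans (cong suc (g≗h i)) (h≡f i) })
    (choose-complete h (unshift-increasing h≡f (f↑ ∘ ℕ.s<s)))))
... | suc _ with h , h≡f ← unshift f (λ { zero f0≡0 → 0≢1+n (trans (sym f0≡0) f0)
                                        ; (suc i) → ≢zero (f↑ {zero} {suc i} ℕ.z<s) }) =
  Any.++⁺ʳ _ (Any.map⁺ (Any.map (λ g≗h i → trans (cong suc (g≗h i)) (h≡f i))
    (choose-complete h (unshift-increasing h≡f f↑))))

minor∈minors : (M : Matrix n n) {f g : Fin k → Fin n} → Increasing f → Increasing g → minor M f g ∈ minors k M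
minor∈minors {n} {k} M {f} {g} f↑ g↑ =
  Any.concat⁺ (Any.map⁺ {f = λ rows → map (minor M rows) (choose n k)} (Any.map (λ rows≗f →
    Any.map⁺ (Any.map (λ cols≗g → minor-cong M (sym ∘ rows≗f) (sym ∘ cols≗g)) (choose-complete g g↑)))
    (choose-complete f f↑)))

Δ-∣-minor : (M : Matrix n n) {f g : Fin k → Fin n} → Increasing f → Increasing g → Δ k M ∣ ∣ minor M f g ∣
Δ-∣-minor M f↑ g↑ = gcdList-∣ (Any.map⁺ {f = ∣_∣} (Any.map (cong ∣_∣) (minor∈minors M f↑ g↑)))

∣-Δ : ∀ {d} (M : Matrix n n) → (∀ f g → d ∣ ∣ minor {k = k} M f g ∣) → d ∣ Δ k M
∣-Δ {n} {k} M d∣minor = ∣-gcdList (All.map⁺ {f = ∣_∣} (All.concat⁺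
  (All.map⁺ {f = λ rows → map (minor M rows) (choose n k)}
    (All.universal (λ rows → All.map⁺ (All.universal (d∣minor rows) (choose n k))) (choose n k)))))

invariant-factor₃ : {M : Matrix n n} {f : ℕ} → Δ 2 M ≡ 1 → Δ 3 M ∣ f → f ∣ Δ 3 M → f ≢ 0 →
                    IsInvariantFactor M 3 f
invariant-factor₃ {M = M} {f = f} Δ₂≡1 Δ₃∣f f∣Δ₃ f≢0 =
  (λ Δ₂≡0 → ℕ.1+n≢0 (trans (sym Δ₂≡1) Δ₂≡0)) , f≢0 ∘ trans (sym Δ₃≡f) ,
  trans Δ₃≡f (sym (trans (cong (f ℕ.*_) Δ₂≡1) (ℕ.*-identityʳ f)))
  where
  Δ₃≡f : Δ 3 M ≡ f
  Δ₃≡f = ∣-antisym Δ₃∣f f∣Δ₃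

pair : Fin n → Fin n → Fin 2 → Fin n
pair a b = lookup (a ∷ b ∷ [])

pair-increasing : {a b : Fin n} → a F.< b → Increasing (pair a b)
pair-increasing a<b {0F} {1F} _ = a<b
pair-increasing _ {suc _} {1F} (ℕ.s≤s ())

triple : Fin n → Fin n → Fin n → Fin 3 → Fin n
triple a b c = lookup (a ∷ b ∷ c ∷ [])

triple-increasing : {a b c : Fin n} → a F.< b → b F.< c → Increasing (triple a b c)
triple-increasing a<b b<c {0F} {1F} _ = a<b
triple-increasing a<b b<c {0F} {2F} _ = <-trans a<b b<c
triple-increasing a<b b<c {1F} {2F} _ = b<c
triple-increasing _ _ {suc _} {1F} (ℕ.s≤s ())
triple-increasing _ _ {2F} {2F} (ℕ.s≤s (ℕ.s≤s ()))

minor₃ : Matrix n n → (a b c p q r : Fin n) → ℤ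
minor₃ M a b c p q r = det₃ (M a p) (M a q) (M a r) (M b p) (M b q) (M b r) (M c p) (M c q) (M c r)

module _ (M : Matrix n n) {a b c p q r : Fin n} where
  private
    ∣-∣-flip : ∀ {x y} → x ≡ - y → ∣ x ∣ ≡ ∣ y ∣
    ∣-∣-flip {y = y} x≡-y = trans (cong ∣_∣ x≡-y) (ℤ.∣-i∣≡∣i∣ y)

  ∣minor₃∣-swap-rows₁₂ : ∣ minor₃ M b a c p q r ∣ ≡ ∣ minor₃ M a b c p q r ∣
  ∣minor₃∣-swap-rows₁₂ = ∣-∣-flip
    (det₃-swap-rows₁₂ (M a p) (M a q) (M a r) (M b p) (M b q) (M b r) (M c p) (M c q) (M c r))

  ∣minor₃∣-swap-rows₂₃ : ∣ minor₃ M a c b p q r ∣ ≡ ∣ minor₃ M a b c p q r ∣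
  ∣minor₃∣-swap-rows₂₃ = ∣-∣-flip
    (det₃-swap-rows₂₃ (M a p) (M a q) (M a r) (M b p) (M b q) (M b r) (M c p) (M c q) (M c r))

  ∣minor₃∣-swap-cols₁₂ : ∣ minor₃ M a b c q p r ∣ ≡ ∣ minor₃ M a b c p q r ∣
  ∣minor₃∣-swap-cols₁₂ = ∣-∣-flip
    (det₃-swap-cols₁₂ (M a p) (M a q) (M a r) (M b p) (M b q) (M b r) (M c p) (M c q) (M c r))

  ∣minor₃∣-swap-cols₂₃ : ∣ minor₃ M a b c p r q ∣ ≡ ∣ minor₃ M a b c p q r ∣
  ∣minor₃∣-swap-cols₂₃ = ∣-∣-flip
    (det₃-swap-cols₂₃ (M a p) (M a q) (M a r) (M b p) (M b q) (M b r) (M c p) (M c q) (M c r))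

module _ (P : Fin n → Fin n → Fin n → Set)
         (swap₁₂ : ∀ {a b c} → P a b c → P b a c)
         (swap₂₃ : ∀ {a b c} → P a b c → P a c b)
         (sorted : ∀ {a b c} → a F.< b → b F.< c → P a b c) where

  private
    insert : ∀ {a b c} → a F.< b → a ≢ c → b ≢ c → P a b c
    insert {a} {b} {c} a<b a≢c b≢c with <-cmp b c | <-cmp a c
    ... | tri< b<c _ _ | _            = sorted a<b b<c
    ... | tri≈ _ b≡c _ | _            = ⊥-elim (b≢c b≡c)
    ... | tri> _ _ c<b | tri< a<c _ _ = swap₂₃ (sorted a<c c<b)
    ... | tri> _ _ c<b | tri≈ _ a≡c _ = ⊥-elim (a≢c a≡c)
    ... | tri> _ _ c<b | tri> _ _ c<a = swap₂₃ (swap₁₂ (sorted c<a a<b))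

  distinct-by-sorting : ∀ {a b c} → a ≢ b → a ≢ c → b ≢ c → P a b c
  distinct-by-sorting {a} {b} a≢b a≢c b≢c with <-cmp a b
  ... | tri< a<b _ _ = insert a<b a≢c b≢c
  ... | tri≈ _ a≡b _ = ⊥-elim (a≢b a≡b)
  ... | tri> _ _ b<a = swap₁₂ (insert b<a b≢c a≢c)

Δ₃-∣-minor₃ : (M : Matrix n n) {a b c p q r : Fin n} → a ≢ b → a ≢ c → b ≢ c → p ≢ q → p ≢ r → q ≢ r →
              Δ 3 M ∣ ∣ minor₃ M a b c p q r ∣
Δ₃-∣-minor₃ M {p = p} {q} {r} a≢b a≢c b≢c p≢q p≢r q≢r =
  distinct-by-sorting (λ a b c → Δ 3 M ∣ ∣ minor₃ M a b c p q r ∣)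
    (subst (Δ 3 M ∣_) (sym (∣minor₃∣-swap-rows₁₂ M)))
    (subst (Δ 3 M ∣_) (sym (∣minor₃∣-swap-rows₂₃ M)))
    sorted-rows a≢b a≢c b≢c
  where
  sorted-rows : ∀ {a b c} → a F.< b → b F.< c → Δ 3 M ∣ ∣ minor₃ M a b c p q r ∣
  sorted-rows {a} {b} {c} a<b b<c =
    distinct-by-sorting (λ p q r → Δ 3 M ∣ ∣ minor₃ M a b c p q r ∣)
      (subst (Δ 3 M ∣_) (sym (∣minor₃∣-swap-cols₁₂ M)))
      (subst (Δ 3 M ∣_) (sym (∣minor₃∣-swap-cols₂₃ M)))
      (λ {p} {q} {r} p<q q<r →
        subst (Δ 3 M ∣_) (cong ∣_∣ (det-3×3 (λ i j → M (triple a b c i) (triple p q r j))))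
          (Δ-∣-minor M (triple-increasing a<b b<c) (triple-increasing p<q q<r)))
      p≢q p≢r q≢r

minor₃-of-values : {D : Fin n → Fin n → ℕ} {a b c p q r : Fin n} {v₁ v₂ v₃ v₄ v₅ v₆ v₇ v₈ v₉ : ℕ} →
  D a p ≡ v₁ → D a q ≡ v₂ → D a r ≡ v₃ →
  D b p ≡ v₄ → D b q ≡ v₅ → D b r ≡ v₆ →
  D c p ≡ v₇ → D c q ≡ v₈ → D c r ≡ v₉ →
  minor₃ (toℤMatrix D) a b c p q r ≡ det₃ (+ v₁) (+ v₂) (+ v₃) (+ v₄) (+ v₅) (+ v₆) (+ v₇) (+ v₈) (+ v₉)
minor₃-of-values refl refl refl refl refl refl refl refl refl = refl

divides-minors₃? : ∀ q (M : Matrix m m) → Dec (∀ a b c p q′ r → q ∣ ∣ minor₃ M a b c p q′ r ∣)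
divides-minors₃? q M =
  all? λ a → all? λ b → all? λ c → all? λ p → all? λ q′ → all? λ r → q ∣? ∣ minor₃ M a b c p q′ r ∣

divides-minors₃ : ∀ {q} (M : Matrix m m) → (∀ a b c p q′ r → q ∣ ∣ minor₃ M a b c p q′ r ∣) →
                  ∀ f g → q ∣ ∣ minor M f g ∣
divides-minors₃ {q = q} M q∣ f g =
  subst (q ∣_) (cong ∣_∣ (sym (det-3×3 (λ i j → M (f i) (g j))))) (q∣ (f 0F) (f 1F) (f 2F) (g 0F) (g 1F) (g 2F))

outside-vertex : k ℕ.< n → (s : Fin k → Fin n) → ∃ λ t → ∀ i → t ≢ s i
outside-vertex {k} {n} k<n s
  with ¬∀⟶∃¬ n (λ t → ∃ λ i → t ≡ s i) (λ t → any? (λ i → t ≟ s i)) not-onto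
  where
  not-onto : ¬ (∀ t → ∃ λ i → t ≡ s i)
  not-onto onto = ℕ.<⇒≱ k<n (injective⇒≤ {f = proj₁ ∘ onto} (λ {t} {t′} i≡i′ →
    trans (proj₂ (onto t)) (trans (cong s i≡i′) (sym (proj₂ (onto t′))))))
... | t , t∉s = t , λ i t≡sᵢ → t∉s (i , t≡sᵢ)

injective⇒surjective : {σ : Fin k → Fin n} → Injective _≡_ _≡_ σ → n ≤ k → ∀ u → ∃ λ i → σ i ≡ u
injective⇒surjective {k = k} {n = n} {σ = σ} σ-inj n≤k u with any? (λ i → σ i ≟ u)
... | yes hit = hit
... | no miss = ⊥-elim (ℕ.<⇒≱ (injective⇒≤ (extended-injective (λ i σᵢ≡u → miss (i , σᵢ≡u)))) n≤k)
  where
  extended-injective : (∀ i → σ i ≢ u) → Injective _≡_ _≡_ (u Vector.∷ σ)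
  extended-injective _ {zero} {zero} _ = refl
  extended-injective σ≢u {zero} {suc j} u≡σⱼ = ⊥-elim (σ≢u j (sym u≡σⱼ))
  extended-injective σ≢u {suc i} {zero} σᵢ≡u = ⊥-elim (σ≢u i σᵢ≡u)
  extended-injective _ {suc i} {suc j} σᵢ≡σⱼ = cong suc (σ-inj σᵢ≡σⱼ)

map-walk : {G : Graph n} {H : Graph k} (f : Fin n → Fin k) → (∀ {u v} → Adj G u v → Adj H (f u) (f v)) →
           ∀ {u v l} → Walk G u v l → Walk H (f u) (f v) l
map-walk f f-adj nil = nil
map-walk f f-adj (cons u~w p) = cons (f-adj u~w) (map-walk f f-adj p)

module _ (H : Graph m) {u v : Fin m} where

  no-shorter-walk₀ : ∀ l → Walk H u v l → ¬ l ℕ.< 0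
  no-shorter-walk₀ _ _ ()

  no-shorter-walk₁ : u ≢ v → ∀ l → Walk H u v l → ¬ l ℕ.< 1
  no-shorter-walk₁ u≢v zero nil _ = u≢v refl
  no-shorter-walk₁ _ (suc _) _ (ℕ.s≤s ())

  no-shorter-walk₂ : u ≢ v → ¬ Adj H u v → ∀ l → Walk H u v l → ¬ l ℕ.< 2
  no-shorter-walk₂ u≢v _ zero nil _ = u≢v refl
  no-shorter-walk₂ _ ¬u~v 1 (cons u~v nil) _ = ¬u~v u~v
  no-shorter-walk₂ _ _ (suc (suc _)) _ (ℕ.s≤s (ℕ.s≤s ()))

≅-from-embedding : {G : Graph n} (H : Graph k) (σ : Fin k → Fin n) → Injective _≡_ _≡_ σ → n ≤ k →
                   (∀ i j → Adj G (σ i) (σ j) ⇔ Adj H i j) → G ≅ H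
≅-from-embedding {n = n} {k = k} {G = G} H σ σ-inj n≤k σ-adj =
  mk↔ₛ′ τ σ τ∘σ σ∘τ ,
  λ u v → subst₂ (λ a b → Adj G a b ⇔ Adj H (τ u) (τ v)) (σ∘τ u) (σ∘τ v) (σ-adj (τ u) (τ v))
  where
  τ : Fin n → Fin k
  τ u = proj₁ (injective⇒surjective σ-inj n≤k u)
  σ∘τ : ∀ u → σ (τ u) ≡ u
  σ∘τ u = proj₂ (injective⇒surjective σ-inj n≤k u)
  τ∘σ : ∀ i → τ (σ i) ≡ i
  τ∘σ i = σ-inj (σ∘τ (σ i))

both : {A B : Set} → A → B → A ⇔ B
both a b = mk⇔ (λ _ → b) (λ _ → a)

neither : {A B : Set} → ¬ A → ¬ B → A ⇔ B
neither ¬a ¬b = mk⇔ (⊥-elim ∘ ¬a) (⊥-elim ∘ ¬b)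

bit : Bool → ℤ
bit false = + 0
bit true  = + 1

module Distances (G : Graph n) {D : Fin n → Fin n → ℕ} (isD : IsDistanceMatrix G D) where

  ~-sym : ∀ {u v} → Adj G u v → Adj G v u
  ~-sym = Graph.sym G

  D-walk : ∀ u v → Walk G u v (D u v)
  D-walk u v = proj₁ (isD u v)

  D-≤ : ∀ {u v l} → Walk G u v l → D u v ≤ l
  D-≤ {u} {v} {l} p = ℕ.≮⇒≥ (proj₂ (isD u v) l p)

  D-refl : ∀ u → D u u ≡ 0
  D-refl u = ℕ.n≤0⇒n≡0 (D-≤ nil)

  D≡0⇒≡ : ∀ {u v} → D u v ≡ 0 → u ≡ v
  D≡0⇒≡ {u} {v} D≡0 with subst (Walk G u v) D≡0 (D-walk u v)
  ... | nil = refl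

  adj⇒≢ : ∀ {u v} → Adj G u v → u ≢ v
  adj⇒≢ u~v refl = irrefl G u~v

  D≡1⇒adj : ∀ {u v} → D u v ≡ 1 → Adj G u v
  D≡1⇒adj {u} {v} D≡1 with subst (Walk G u v) D≡1 (D-walk u v)
  ... | cons u~v nil = u~v

  adj⇒D≡1 : ∀ {u v} → Adj G u v → D u v ≡ 1
  adj⇒D≡1 u~v = ℕ.≤-antisym (D-≤ (cons u~v nil)) (ℕ.n≢0⇒n>0 (adj⇒≢ u~v ∘ D≡0⇒≡))

  geodesic-step : ∀ {u v l} → D u v ≡ suc l → ∃ λ w → Adj G u w × D w v ≡ l
  geodesic-step {u} {v} D≡1+l with subst (Walk G u v) D≡1+l (D-walk u v)
  ... | cons {w = w} u~w p = w , u~w , ℕ.≤-antisym (D-≤ p)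
                               (ℕ.s≤s⁻¹ (subst (_≤ suc (D w v)) D≡1+l (D-≤ (cons u~w (D-walk w v)))))

  -- Follow a geodesic from a vertex t outside the image of s towards s 0F:
  -- the last vertex before it enters the image is adjacent to it.
  neighbour-outside : suc k ℕ.< n → (s : Fin (suc k) → Fin n) →
                      ∃ λ w → (∀ i → w ≢ s i) × ∃ λ i → Adj G w (s i)
  neighbour-outside k<n s with t , t∉s ← outside-vertex k<n s = approach (D t (s 0F)) refl t∉s
    where
    approach : ∀ d {t} → D t (s 0F) ≡ d → (∀ i → t ≢ s i) →
               ∃ λ w → (∀ i → w ≢ s i) × ∃ λ i → Adj G w (s i)
    approach zero D≡0 t∉s = ⊥-elim (t∉s 0F (D≡0⇒≡ D≡0))
    approach (suc d) {t} D≡1+d t∉s with geodesic-step D≡1+d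
    ... | t′ , t~t′ , D≡d with any? (λ i → t′ ≟ s i)
    ...   | yes (i , t′≡sᵢ) = t , t∉s , i , subst (Adj G t) t′≡sᵢ t~t′
    ...   | no t′∉s = approach d D≡d (λ i t′≡sᵢ → t′∉s (i , t′≡sᵢ))

  Δ₂≡1-ordered : ∀ {u v} → Adj G u v → u F.< v → Δ 2 (toℤMatrix D) ≡ 1
  Δ₂≡1-ordered {u} {v} u~v u<v = ∣1⇒≡1 (subst (Δ 2 (toℤMatrix D) ∣_) edge-minor
    (Δ-∣-minor (toℤMatrix D) (pair-increasing u<v) (pair-increasing u<v)))
    where
    values : ∀ {a b c d} → a ≡ 0 → b ≡ 1 → c ≡ 1 → d ≡ 0 → ∣ det₂ (+ a) (+ b) (+ c) (+ d) ∣ ≡ 1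
    values refl refl refl refl = refl
    edge-minor : ∣ minor (toℤMatrix D) (pair u v) (pair u v) ∣ ≡ 1
    edge-minor = trans (cong ∣_∣ (det-2×2 (λ i j → + D (pair u v i) (pair u v j))))
      (values (D-refl u) (adj⇒D≡1 u~v) (adj⇒D≡1 (~-sym u~v)) (D-refl v))

  Δ₂≡1 : ∀ {u v} → Adj G u v → Δ 2 (toℤMatrix D) ≡ 1
  Δ₂≡1 {u} {v} u~v with <-cmp u v
  ... | tri< u<v _ _ = Δ₂≡1-ordered u~v u<v
  ... | tri≈ _ u≡v _ = ⊥-elim (adj⇒≢ u~v u≡v)
  ... | tri> _ _ v<u = Δ₂≡1-ordered (~-sym u~v) v<u

  module Bipartition (c : Fin n → Bool) (proper : ∀ u v → Adj G u v → c u ≢ c v) where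

    colour-flips : ∀ {u w} → Adj G u w → c w ≡ not (c u)
    colour-flips {u} {w} u~w = ¬-not (proper w u (~-sym u~w))

    colour-returns : ∀ {u m v} → Adj G u m → Adj G m v → c v ≡ c u
    colour-returns {u} u~m m~v = trans (colour-flips m~v) (trans (cong not (colour-flips u~m)) (not-involutive (c u)))

    ¬adj-two-step : ∀ {u m v} → Adj G u m → Adj G m v → ¬ Adj G u v
    ¬adj-two-step u~m m~v u~v = not-¬ (colour-returns u~m m~v) (colour-flips u~v)

    walk-parity : ∀ {u v l} → Walk G u v l → ∃ λ r → + l ≡ bit (c u) + bit (c v) + + 2 * r
    walk-parity {u} nil = - bit (c u) , empty (bit (c u))
      where
      empty : ∀ x → + 0 ≡ x + x + + 2 * (- x)
      empty = solve-∀
    walk-parity {u} {v} {suc l} (cons {w = w} u~w p) with r , l≡ ← walk-parity p =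
      r + + 1 - bit (c u) , (begin
        + suc l                                         ≡⟨ cong (_+_ (+ 1)) l≡ ⟩
        + 1 + (bit (c w) + bit (c v) + + 2 * r)         ≡⟨ cong (λ b → + 1 + (b + bit (c v) + + 2 * r)) bit-w ⟩
        + 1 + (+ 1 - bit (c u) + bit (c v) + + 2 * r)   ≡⟨ extend (bit (c u)) (bit (c v)) r ⟩
        bit (c u) + bit (c v) + + 2 * (r + + 1 - bit (c u)) ∎)
      where
      open ≡-Reasoning
      bit-not : ∀ b → bit (not b) ≡ + 1 - bit b
      bit-not false = refl
      bit-not true  = refl
      bit-w : bit (c w) ≡ + 1 - bit (c u)
      bit-w = trans (cong bit (colour-flips u~w)) (bit-not (c u))
      extend : ∀ x y r → + 1 + (+ 1 - x + y + + 2 * r) ≡ x + y + + 2 * (r + + 1 - x)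
      extend = solve-∀

    Δ₃-even : 2 ∣ Δ 3 (toℤMatrix D)
    Δ₃-even = ∣-Δ (toℤMatrix D) λ f g →
      subst (2 ∣_) (cong ∣_∣ (sym (det-cong (λ i j → proj₂ (parity (f i) (g j))))))
        (det-even (bit ∘ c ∘ f) (bit ∘ c ∘ g) (λ i j → proj₁ (parity (f i) (g j))))
      where
      parity : ∀ u v → ∃ λ r → + D u v ≡ bit (c u) + bit (c v) + + 2 * r
      parity u v = walk-parity (D-walk u v)

    two-step⇒D≡2 : ∀ {u m v} → u ≢ v → Adj G u m → Adj G m v → D u v ≡ 2
    two-step⇒D≡2 {u} {m} {v} u≢v u~m m~v =
      ℕ.≤-antisym (D-≤ (cons u~m (cons m~v nil))) (at-least-two (D u v) refl)
      where
      at-least-two : ∀ d → D u v ≡ d → 2 ≤ d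
      at-least-two 0 D≡0 = ⊥-elim (u≢v (D≡0⇒≡ D≡0))
      at-least-two 1 D≡1 = ⊥-elim (¬adj-two-step u~m m~v (D≡1⇒adj D≡1))
      at-least-two (suc (suc _)) _ = ℕ.s≤s (ℕ.s≤s ℕ.z≤n)

    three-step⇒D≡3 : ∀ {u a b v} → ¬ Adj G u v → Adj G u a → Adj G a b → Adj G b v → D u v ≡ 3
    three-step⇒D≡3 {u} {a} {b} {v} ¬u~v u~a a~b b~v =
      ℕ.≤-antisym (D-≤ (cons u~a (cons a~b (cons b~v nil)))) (at-least-three (D u v) refl)
      where
      opposite : c v ≡ not (c u)
      opposite = trans (colour-returns a~b b~v) (colour-flips u~a)
      at-least-three : ∀ d → D u v ≡ d → 3 ≤ d
      at-least-three 0 D≡0 with refl ← D≡0⇒≡ D≡0 = ⊥-elim (not-¬ refl opposite)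
      at-least-three 1 D≡1 = ⊥-elim (¬u~v (D≡1⇒adj D≡1))
      at-least-three 2 D≡2 with w , u~w , D≡1 ← geodesic-step D≡2 =
        ⊥-elim (not-¬ (colour-returns u~w (D≡1⇒adj D≡1)) opposite)
      at-least-three (suc (suc (suc _))) _ = ℕ.s≤s (ℕ.s≤s (ℕ.s≤s ℕ.z≤n))

    record Path₃ : Set where
      constructor path
      field
        {x y z} : Fin n
        x~y : Adj G x y
        y~z : Adj G y z
        x≢z : x ≢ z

    record Square : Set where
      constructor square
      field
        {x y z w} : Fin n
        x~y : Adj G x y
        y~z : Adj G y z
        z~w : Adj G z w
        w~x : Adj G w x
        x≢z : x ≢ z
        y≢w : y ≢ w

    path-from-same-colour : ∀ {u v} → u ≢ v → c u ≡ c v → Path₃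
    path-from-same-colour {u} {v} u≢v same with D u v in D≡
    ... | 0 = ⊥-elim (u≢v (D≡0⇒≡ D≡))
    ... | 1 = ⊥-elim (not-¬ (sym same) (colour-flips (D≡1⇒adj D≡)))
    ... | suc (suc l) with y , u~y , D≡′ ← geodesic-step D≡ with z , y~z , D≡″ ← geodesic-step D≡′ =
      path u~y y~z λ u≡z → ℕ.m≢1+n+m l (trans (sym D≡″) (subst (λ t → D t v ≡ suc (suc l)) u≡z D≡))

    path-exists : 3 ≤ n → Path₃
    path-exists 3≤n with u , v , u<v , same ← pigeonhole 3≤n (Inverse.from 2↔Bool ∘ c) =
      path-from-same-colour (<⇒≢ u<v) (trans (sym (Inverse.strictlyInverseˡ 2↔Bool (c u)))
        (trans (cong (Inverse.to 2↔Bool) same) (Inverse.strictlyInverseˡ 2↔Bool (c v))))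

    -- rows and columns x y z: det [[0,1,2],[1,0,1],[2,1,0]] = 4
    path⇒Δ₃∣4 : Path₃ → Δ 3 (toℤMatrix D) ∣ 4
    path⇒Δ₃∣4 (path {x} {y} {z} x~y y~z x≢z) =
      subst (Δ 3 (toℤMatrix D) ∣_)
        (cong ∣_∣ (minor₃-of-values {D = D} (D-refl x) (adj⇒D≡1 x~y) (two-step⇒D≡2 x≢z x~y y~z)
                                            (adj⇒D≡1 y~x) (D-refl y) (adj⇒D≡1 y~z)
                                            (two-step⇒D≡2 (x≢z ∘ sym) z~y y~x) (adj⇒D≡1 z~y) (D-refl z)))
        (Δ₃-∣-minor₃ (toℤMatrix D) x≢y x≢z y≢z x≢y x≢z y≢z)
      where
      y~x : Adj G y x
      y~x = ~-sym x~y
      z~y : Adj G z y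
      z~y = ~-sym y~z
      x≢y : x ≢ y
      x≢y = adj⇒≢ x~y
      y≢z : y ≢ z
      y≢z = adj⇒≢ y~z

    -- rows o a₁ a₂, columns o a₁ a₃: det [[0,1,1],[1,0,2],[1,2,2]] = 2
    claw⇒Δ₃∣2 : ∀ {o a₁ a₂ a₃} → Adj G o a₁ → Adj G o a₂ → Adj G o a₃ →
                a₁ ≢ a₂ → a₁ ≢ a₃ → a₂ ≢ a₃ →
                Δ 3 (toℤMatrix D) ∣ 2
    claw⇒Δ₃∣2 {o} {a₁} {a₂} {a₃} o~a₁ o~a₂ o~a₃ a₁≢a₂ a₁≢a₃ a₂≢a₃ =
      subst (Δ 3 (toℤMatrix D) ∣_)
        (cong ∣_∣ (minor₃-of-values {D = D} (D-refl o) (adj⇒D≡1 o~a₁) (adj⇒D≡1 o~a₃)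
                                            (adj⇒D≡1 a₁~o) (D-refl a₁) (two-step⇒D≡2 a₁≢a₃ a₁~o o~a₃)
                                            (adj⇒D≡1 a₂~o) (two-step⇒D≡2 (a₁≢a₂ ∘ sym) a₂~o o~a₁)
                                            (two-step⇒D≡2 a₂≢a₃ a₂~o o~a₃)))
        (Δ₃-∣-minor₃ (toℤMatrix D) (adj⇒≢ o~a₁) (adj⇒≢ o~a₂) a₁≢a₂
                                   (adj⇒≢ o~a₁) (adj⇒≢ o~a₃) a₁≢a₃)
      where
      a₁~o : Adj G a₁ o
      a₁~o = ~-sym o~a₁
      a₂~o : Adj G a₂ o
      a₂~o = ~-sym o~a₂

    -- rows v₀ v₁ v₂, columns v₁ v₂ v₃: det [[1,2,3],[0,1,2],[1,0,1]] = 2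
    path₄⇒Δ₃∣2 : ∀ {v₀ v₁ v₂ v₃} → Adj G v₀ v₁ → Adj G v₁ v₂ → Adj G v₂ v₃ →
                 v₀ ≢ v₂ → v₁ ≢ v₃ → ¬ Adj G v₀ v₃ →
                 Δ 3 (toℤMatrix D) ∣ 2
    path₄⇒Δ₃∣2 v₀~v₁ v₁~v₂ v₂~v₃ v₀≢v₂ v₁≢v₃ ¬v₀~v₃ =
      subst (Δ 3 (toℤMatrix D) ∣_)
        (cong ∣_∣ (minor₃-of-values {D = D} (adj⇒D≡1 v₀~v₁) (two-step⇒D≡2 v₀≢v₂ v₀~v₁ v₁~v₂)
                                            (three-step⇒D≡3 ¬v₀~v₃ v₀~v₁ v₁~v₂ v₂~v₃)
                                            (D-refl _) (adj⇒D≡1 v₁~v₂) (two-step⇒D≡2 v₁≢v₃ v₁~v₂ v₂~v₃)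
                                            (adj⇒D≡1 (~-sym v₁~v₂)) (D-refl _) (adj⇒D≡1 v₂~v₃)))
        (Δ₃-∣-minor₃ (toℤMatrix D) (adj⇒≢ v₀~v₁) v₀≢v₂ (adj⇒≢ v₁~v₂)
                                   (adj⇒≢ v₁~v₂) v₁≢v₃ (adj⇒≢ v₂~v₃))

    Δ₃∣2-from-path : 3 ℕ.< n → Path₃ → (Square → Δ 3 (toℤMatrix D) ∣ 2) → Δ 3 (toℤMatrix D) ∣ 2
    Δ₃∣2-from-path 3<n (path {x} {y} {z} x~y y~z x≢z) from-square
      with neighbour-outside 3<n (triple x y z)
    ... | w , w∉ , 1F , w~y = claw⇒Δ₃∣2 (~-sym x~y) y~z (~-sym w~y) x≢z (w∉ 0F ∘ sym) (w∉ 2F ∘ sym)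
    ... | w , w∉ , 0F , w~x with D w z ℕ.≟ 1
    ...   | yes D≡1 = from-square (square x~y y~z (~-sym (D≡1⇒adj D≡1)) w~x x≢z (w∉ 1F ∘ sym))
    ...   | no D≢1 = path₄⇒Δ₃∣2 w~x x~y y~z (w∉ 1F) x≢z (D≢1 ∘ adj⇒D≡1)
    Δ₃∣2-from-path 3<n (path {x} {y} {z} x~y y~z x≢z) from-square
        | w , w∉ , 2F , w~z with D w x ℕ.≟ 1
    ...   | yes D≡1 = from-square (square x~y y~z (~-sym w~z) (D≡1⇒adj D≡1) x≢z (w∉ 1F ∘ sym))
    ...   | no D≢1 = path₄⇒Δ₃∣2 w~z (~-sym y~z) (~-sym x~y) (w∉ 1F) (x≢z ∘ sym) (D≢1 ∘ adj⇒D≡1)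

    Δ₃∣2-from-square : 4 ℕ.< n → Square → Δ 3 (toℤMatrix D) ∣ 2
    Δ₃∣2-from-square 4<n (square {x} {y} {z} {w} x~y y~z z~w w~x x≢z y≢w)
      with neighbour-outside 4<n (lookup (x ∷ y ∷ z ∷ w ∷ []))
    ... | u , u∉ , 0F , u~x = claw⇒Δ₃∣2 x~y (~-sym w~x) (~-sym u~x) y≢w (u∉ 1F ∘ sym) (u∉ 3F ∘ sym)
    ... | u , u∉ , 1F , u~y = claw⇒Δ₃∣2 (~-sym x~y) y~z (~-sym u~y) x≢z (u∉ 0F ∘ sym) (u∉ 2F ∘ sym)
    ... | u , u∉ , 2F , u~z = claw⇒Δ₃∣2 (~-sym y~z) z~w (~-sym u~z) y≢w (u∉ 1F ∘ sym) (u∉ 3F ∘ sym)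
    ... | u , u∉ , 3F , u~w = claw⇒Δ₃∣2 w~x (~-sym z~w) (~-sym u~w) x≢z (u∉ 0F ∘ sym) (u∉ 2F ∘ sym)

    path≅P3 : n ≤ 3 → Path₃ → G ≅ P3
    path≅P3 n≤3 (path {x} {y} {z} x~y y~z x≢z) =
      ≅-from-embedding {G = G} P3 (triple x y z) (λ {i} {j} → lookup-injective distinct i j) n≤3 adjacency
      where
      distinct : Unique (x ∷ y ∷ z ∷ [])
      distinct = (adj⇒≢ x~y ∷ x≢z ∷ []) ∷ (adj⇒≢ y~z ∷ []) ∷ [] ∷ []
      adjacency : ∀ i j → Adj G (triple x y z i) (triple x y z j) ⇔ P3-adj i j
      adjacency 0F 0F = neither (irrefl G {x}) (λ ())
      adjacency 0F 1F = both x~y tt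
      adjacency 0F 2F = neither (¬adj-two-step x~y y~z) (λ ())
      adjacency 1F 0F = both (~-sym x~y) tt
      adjacency 1F 1F = neither (irrefl G {y}) (λ ())
      adjacency 1F 2F = both y~z tt
      adjacency 2F 0F = neither (¬adj-two-step (~-sym y~z) (~-sym x~y)) (λ ())
      adjacency 2F 1F = both (~-sym y~z) tt
      adjacency 2F 2F = neither (irrefl G {z}) (λ ())

    -- The parts {0, 1} and {2, 3} of K22 are sent to {x, z} and {y, w}.
    square≅K22 : n ≤ 4 → Square → G ≅ K22
    square≅K22 n≤4 (square {x} {y} {z} {w} x~y y~z z~w w~x x≢z y≢w) =
      ≅-from-embedding {G = G} K22 σ (λ {i} {j} → lookup-injective distinct i j) n≤4 adjacency
      where
      σ : Fin 4 → Fin n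
      σ = lookup (x ∷ z ∷ y ∷ w ∷ [])
      distinct : Unique (x ∷ z ∷ y ∷ w ∷ [])
      distinct = (x≢z ∷ adj⇒≢ x~y ∷ adj⇒≢ (~-sym w~x) ∷ [])
               ∷ (adj⇒≢ (~-sym y~z) ∷ adj⇒≢ z~w ∷ []) ∷ (y≢w ∷ []) ∷ [] ∷ []
      same-side : {b : Bool} → ¬ (b ≢ b)
      same-side b≢b = b≢b refl
      adjacency : ∀ i j → Adj G (σ i) (σ j) ⇔ K22-adj i j
      adjacency 0F 0F = neither (irrefl G {x}) same-side
      adjacency 0F 1F = neither (¬adj-two-step x~y y~z) same-side
      adjacency 0F 2F = both x~y (λ ())
      adjacency 0F 3F = both (~-sym w~x) (λ ())
      adjacency 1F 0F = neither (¬adj-two-step (~-sym y~z) (~-sym x~y)) same-side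
      adjacency 1F 1F = neither (irrefl G {z}) same-side
      adjacency 1F 2F = both (~-sym y~z) (λ ())
      adjacency 1F 3F = both z~w (λ ())
      adjacency 2F 0F = both (~-sym x~y) (λ ())
      adjacency 2F 1F = both y~z (λ ())
      adjacency 2F 2F = neither (irrefl G {y}) same-side
      adjacency 2F 3F = neither (¬adj-two-step (~-sym x~y) (~-sym w~x)) same-side
      adjacency 3F 0F = both w~x (λ ())
      adjacency 3F 1F = both (~-sym z~w) (λ ())
      adjacency 3F 2F = neither (¬adj-two-step w~x x~y) same-side
      adjacency 3F 3F = neither (irrefl G {w}) same-side

    Δ₃∣2-unless-exceptional : ¬ G ≅ K22 → ¬ G ≅ P3 → Path₃ → Δ 3 (toℤMatrix D) ∣ 2
    Δ₃∣2-unless-exceptional ¬K22 ¬P3 xyz with n ℕ.≤? 3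
    ... | yes n≤3 = ⊥-elim (¬P3 (path≅P3 n≤3 xyz))
    ... | no n≰3 = Δ₃∣2-from-path (ℕ.≰⇒> n≰3) xyz from-square
      where
      from-square : Square → Δ 3 (toℤMatrix D) ∣ 2
      from-square sq with n ℕ.≤? 4
      ... | yes n≤4 = ⊥-elim (¬K22 (square≅K22 n≤4 sq))
      ... | no n≰4 = Δ₃∣2-from-square (ℕ.≰⇒> n≰4) sq

≅-distance : {G : Graph n} {H : Graph k} {D : Fin n → Fin n → ℕ} {d : Fin k → Fin k → ℕ} →
             ((f , _) : G ≅ H) → IsDistanceMatrix G D → IsDistanceMatrix H d →
             ∀ u v → D u v ≡ d (Inverse.to f u) (Inverse.to f v)
≅-distance {G = G} {H} (f , f-adj) isD isd u v = ℕ.≤-antisym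
  (Distances.D-≤ G isD (subst₂ (λ a b → Walk G a b _) (strictlyInverseʳ u) (strictlyInverseʳ v)
    (map-walk from from-adj (Distances.D-walk H isd (to u) (to v)))))
  (Distances.D-≤ H isd (map-walk to (Equivalence.to (f-adj _ _)) (Distances.D-walk G isD u v)))
  where
  open Inverse f
  from-adj : ∀ {a b} → Adj H a b → Adj G (from a) (from b)
  from-adj {a} {b} a~b = Equivalence.from (f-adj (from a) (from b))
    (subst₂ (Adj H) (sym (strictlyInverseˡ a)) (sym (strictlyInverseˡ b)) a~b)

∣Δ-via-≅ : {G : Graph n} {H : Graph m} {D : Fin n → Fin n → ℕ} {d : Fin m → Fin m → ℕ} {q : ℕ} →
           G ≅ H → IsDistanceMatrix G D → IsDistanceMatrix H d →
           (∀ (f g : Fin k → Fin m) → q ∣ ∣ minor (toℤMatrix d) f g ∣) → q ∣ Δ k (toℤMatrix D)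
∣Δ-via-≅ {D = D} {q = q} G≅H isD isd q∣minors = ∣-Δ (toℤMatrix D) λ f g →
  subst (q ∣_) (cong ∣_∣ (det-cong (λ i j → cong +_ (sym (≅-distance G≅H isD isd (f i) (g j))))))
    (q∣minors (Inverse.to (proj₁ G≅H) ∘ f) (Inverse.to (proj₁ G≅H) ∘ g))

P3-dist : Fin 3 → Fin 3 → ℕ
P3-dist u v = ℕ.∣ F.toℕ u - F.toℕ v ∣

P3-distance : IsDistanceMatrix P3 P3-dist
P3-distance 0F 0F = nil , no-shorter-walk₀ P3
P3-distance 0F 1F = cons tt nil , no-shorter-walk₁ P3 (λ ())
P3-distance 0F 2F = cons {w = 1F} tt (cons tt nil) , no-shorter-walk₂ P3 (λ ()) (λ ())
P3-distance 1F 0F = cons tt nil , no-shorter-walk₁ P3 (λ ())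
P3-distance 1F 1F = nil , no-shorter-walk₀ P3
P3-distance 1F 2F = cons tt nil , no-shorter-walk₁ P3 (λ ())
P3-distance 2F 0F = cons {w = 1F} tt (cons tt nil) , no-shorter-walk₂ P3 (λ ()) (λ ())
P3-distance 2F 1F = cons tt nil , no-shorter-walk₁ P3 (λ ())
P3-distance 2F 2F = nil , no-shorter-walk₀ P3

K22-dist : Fin 4 → Fin 4 → ℕ
K22-dist u v with u ≟ v | side u Bool.≟ side v
... | yes _ | _     = 0
... | no _  | yes _ = 2
... | no _  | no _  = 1

across : Fin 4 → Fin 4
across 0F = 2F
across 1F = 2F
across 2F = 0F
across 3F = 0F

across-opposite : ∀ u → side u ≢ side (across u)
across-opposite 0F ()
across-opposite 1F ()
across-opposite 2F ()
across-opposite 3F ()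

K22-distance : IsDistanceMatrix K22 K22-dist
K22-distance u v with u ≟ v | side u Bool.≟ side v
... | yes refl | _ = nil , no-shorter-walk₀ K22
... | no u≢v | yes same =
  cons (across-opposite u) (cons (λ e → across-opposite u (trans same (sym e))) nil) ,
  no-shorter-walk₂ K22 u≢v (λ u~v → u~v same)
... | no u≢v | no differ = cons differ nil , no-shorter-walk₁ K22 u≢v

4∣P3-minors : ∀ f g → 4 ∣ ∣ minor (toℤMatrix P3-dist) f g ∣
4∣P3-minors = divides-minors₃ (toℤMatrix P3-dist) (toWitness {a? = divides-minors₃? 4 (toℤMatrix P3-dist)} _)

4∣K22-minors : ∀ f g → 4 ∣ ∣ minor (toℤMatrix K22-dist) f g ∣
4∣K22-minors = divides-minors₃ (toℤMatrix K22-dist) (toWitness {a? = divides-minors₃? 4 (toℤMatrix K22-dist)} _)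

mainTheorem6 : (n : ℕ) (G : Graph n) → 3 ≤ n → Connected G → Bipartite G →
    (D : Fin n → Fin n → ℕ) → IsDistanceMatrix G D →
    ((G ≅ K22 ⊎ G ≅ P3) → IsInvariantFactor (toℤMatrix D) 3 4)
    × ((¬ (G ≅ K22) × ¬ (G ≅ P3)) → IsInvariantFactor (toℤMatrix D) 3 2)
mainTheorem6 n G 3≤n _ (c , proper) D isD = exceptional , generic
  where
  open Distances G isD
  open Bipartition c proper

  xyz : Path₃
  xyz = path-exists 3≤n

  Δ₂-one : Δ 2 (toℤMatrix D) ≡ 1
  Δ₂-one = Δ₂≡1 (Path₃.x~y xyz)

  4∣Δ₃ : G ≅ K22 ⊎ G ≅ P3 → 4 ∣ Δ 3 (toℤMatrix D)
  4∣Δ₃ (inj₁ G≅K22) = ∣Δ-via-≅ G≅K22 isD K22-distance 4∣K22-minors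
  4∣Δ₃ (inj₂ G≅P3) = ∣Δ-via-≅ G≅P3 isD P3-distance 4∣P3-minors

  exceptional : G ≅ K22 ⊎ G ≅ P3 → IsInvariantFactor (toℤMatrix D) 3 4
  exceptional G≅H = invariant-factor₃ {M = toℤMatrix D} Δ₂-one (path⇒Δ₃∣4 xyz) (4∣Δ₃ G≅H) (λ ())

  generic : ¬ G ≅ K22 × ¬ G ≅ P3 → IsInvariantFactor (toℤMatrix D) 3 2
  generic (¬K22 , ¬P3) =
    invariant-factor₃ {M = toℤMatrix D} Δ₂-one (Δ₃∣2-unless-exceptional ¬K22 ¬P3 xyz) Δ₃-even (λ ())
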